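{- Let $p$ be a prime, let $m$ be a positive integer, and let $n$ be an odd integer divisible by $p^m$. If the integer $k$ is divisible by $p$, then $B_{n-1,k-1}$, $C_{n-1,k-1}$ and $D_{n-1,k-1}$ are all divisible by $p^m$.
   Context: Permutations of $[N]=\{1,\dots,N\}$ are written as words $a_1\cdots a_N$. An ascent is an index $i$ ($1\le i\le N-1$) with $a_i<a_{i+1}$; an inversion is a pair $(i,j)$ with $i<j$ and $a_i>a_j$. For any integer $k$, $E(N,k)$ is the set of permutations of $[N]$ with exactly $k$ ascents (empty if $k<0$ or $k>N-1$); $E_{\rm e}(N,k)$, $E_{\rm o}(N,k)$ are its subsets of permutations with an even, respectively odd, number of inversions; $B_{N,k}=|E_{\rm e}(N,k)|$, $C_{N,k}=|E_{\rm o}(N,k)|$, $D_{N,k}=B_{N,k}-C_{N,k}$. -}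

module Defs where

open import Data.Nat using (ℕ; zero; suc; _+_; _<ᵇ_; _≡ᵇ_; _%_)
open import Data.Integer as ℤ using (ℤ; +_; _-_)
open import Data.Integer.Properties using () renaming (_≟_ to _≟ℤ_)
open import Data.Fin using (Fin; toℕ)
open import Data.Fin.Base using () renaming (zero to fzero)
open import Data.List using (List; []; _∷_; [_]; map; concatMap; filterᵇ; length)
open import Data.Bool.ListAction using (any)
open import Data.List.Base using (allFin)
open import Data.Bool using (Bool; true; false; _∧_; not; if_then_else_)
open import Relation.Nullary.Decidable using (⌊_⌋)

-- All words of length L over the alphabet {0,…,N-1} (a shift of [N] = {1,…,N};
-- the shift does not affect ascents or inversions).
words : ℕ → ℕ → List (List ℕ)
words N zero    = [ [] ]
words N (suc L) = concatMap (λ x → map (toℕ x ∷_) (words N L)) (allFin N)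

distinct : List ℕ → Bool
distinct []       = true
distinct (a ∷ as) = not (any (λ b → a ≡ᵇ b) as) ∧ distinct as

perms : ℕ → List (List ℕ)
perms N = filterᵇ distinct (words N N)

ascents : List ℕ → ℕ
ascents []           = 0
ascents (a ∷ [])     = 0
ascents (a ∷ b ∷ as) = (if a <ᵇ b then 1 else 0) + ascents (b ∷ as)

inversions : List ℕ → ℕ
inversions []       = 0
inversions (a ∷ as) = length (filterᵇ (λ b → b <ᵇ a) as) + inversions as

evenInv : List ℕ → Bool
evenInv w = inversions w % 2 ≡ᵇ 0

hasAscents : ℤ → List ℕ → Bool
hasAscents k w = ⌊ (+ ascents w) ≟ℤ k ⌋

B : ℕ → ℤ → ℕ
B N k = length (filterᵇ (λ w → hasAscents k w ∧ evenInv w) (perms N))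

C : ℕ → ℤ → ℕ
C N k = length (filterᵇ (λ w → hasAscents k w ∧ not (evenInv w)) (perms N))

D : ℕ → ℤ → ℤ
D N k = + B N k - + C N k

{-# OPTIONS --safe #-}
-- Let n be odd, N = n - 1, and read a permutation u of {0,…,N-1} as the cyclic word u N of
-- length n.  Adding 1 modulo n to every letter and rotating so that N is last again defines
-- a map σ on these permutations with σⁿ = id.  It preserves the number of ascents and, as n
-- is odd, the parity of the number of inversions, so it acts on the sets counted by B and C.
-- Write n = M pᵐ and let p divide k = asc u + 1, the number of cyclic ascents of u N.  If
-- σ^(M p^(m-1)) fixed u, the cyclic word w would satisfy w(i) ≡ w(i + r) + n/p (mod n) for
-- some r, and applying this p times gives n ∣ p r.  The gaps w(i) - w(i+1) mod n have period
-- n, over which they sum to n k, and by the symmetry also period r; so the first r of them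
-- sum to r k ≡ 0, while telescoping makes that sum ≡ w(0) - w(r) ≡ n/p (mod n).  Hence all
-- orbits of σᴹ have exactly pᵐ elements.

module Submission where

open import Defs
open import Data.Nat using (ℕ; zero; suc; pred; _+_; _*_; _^_; _∸_; _≤_; _<_; _%_; _/_; _<ᵇ_; _≡ᵇ_;
  _≟_; _<?_; z≤n; z<s; s≤s; s≤s⁻¹; NonZero; >-nonZero; >-nonZero⁻¹; ≢-nonZero; nonTrivial⇒n>1;
  nonTrivial⇒≢1)
open import Data.Nat.Properties
open import Data.Nat.DivMod using (m≡m%n+[m/n]*n; m%n<n; m%n≤n; m<n⇒m%n≡m; m%n%n≡m%n; %-distribˡ-+;
  [m+n]%n≡m%n; [m+kn]%n≡m%n; n%n≡0)
open import Data.Nat.Divisibility using (_∣_; _∣?_; divides; _∣0; ∣-refl; ∣m∣n⇒∣m+n; *-monoˡ-∣;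
  *-cancelˡ-∣; ∣1⇒≡1; ∣⇒≤; m%n≡0⇒n∣m; ∣n⇒∣m*n)
open import Data.Nat.GCD using (GCD; gcd; gcd-GCD; module Bézout)
open import Data.Nat.Coprimality using (Coprime; coprime-divisor)
open import Data.Nat.Primality using (Prime; prime⇒irreducible; prime⇒nonZero; prime⇒nonTrivial)
open import Data.Nat.GeneralisedArithmetic using (fold; fold-+)
open import Data.Nat.Induction using (<-wellFounded)
open import Data.Nat.Tactic.RingSolver using (solve-∀)
open import Algebra.Properties.CommutativeSemigroup +-commutativeSemigroup
  using (x∙yz≈y∙xz; interchange)
open import Data.Fin using (Fin; toℕ; fromℕ<)
open import Data.Fin.Properties using (toℕ-fromℕ<; toℕ-injective; toℕ<n)
open import Data.Bool using (Bool; true; false; T; T?; not; _∧_; if_then_else_)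
open import Data.Bool.Properties using (T-∧; T-≡)
open import Data.Bool.ListAction using (any)
open import Data.List.Base using (List; []; _∷_; _++_; [_]; length; map; filter; filterᵇ; concatMap;
  cartesianProductWith; allFin; upTo; applyUpTo)
open import Data.List.Properties using (∷-injective; ++-assoc; ++-identityʳ; length-++; length-upTo;
  length-applyUpTo; map-++; map-upTo; map-cong-local; upTo-∷ʳ; filter-++; filter-all; filter-none;
  filter-complete; ≡-dec)
open import Data.List.Membership.Propositional using (_∈_; _∉_)
open import Data.List.Membership.Propositional.Properties using (∈-++⁺ˡ; ∈-++⁺ʳ; ∈-++⁻; ∈-filter⁺;
  ∈-filter⁻; ∈-applyUpTo⁺; ∈-applyUpTo⁻; ∈-cartesianProductWith⁺; ∈-cartesianProductWith⁻; ∈-allFin;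
  ∈-upTo⁺; ∈-upTo⁻)
open import Data.List.Membership.Propositional.Properties.WithK using (unique∧set⇒bag)
open import Data.List.Relation.Unary.Any using (here; there)
open import Data.List.Relation.Unary.All as All using (All; []; _∷_)
open import Data.List.Relation.Unary.All.Properties using (All¬⇒¬Any; ++⁻ˡ; ++⁻ʳ)
open import Data.List.Relation.Unary.Unique.Propositional using (Unique; []; _∷_)
import Data.List.Relation.Unary.Unique.Propositional.Properties as Unique
open import Data.List.Relation.Binary.Subset.Propositional using (_⊆_)
open import Data.List.Relation.Binary.BagAndSetEquality using (_∼[_]_; set; ∼bag⇒↭)
open import Data.List.Relation.Binary.Permutation.Propositional
  using (_↭_; prep; ↭-sym; ↭⇒↭ₛ; module PermutationReasoning)
open import Data.List.Relation.Binary.Permutation.Propositional.Properties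
  using (↭-length; All-resp-↭; ∈-resp-↭; shift; ++-comm; map⁺; drop-mid; ++⁺ʳ)
open import Data.Product using (∃; _×_; _,_; proj₁; proj₂)
import Data.Product as Product
open import Data.Sum using (inj₁; inj₂)
open import Data.Empty using (⊥)
open import Function.Base using (id; _∘_; _∘′_)
open import Function.Bundles using (Equivalence; mk⇔)
open import Induction.WellFounded using (Acc; acc)
open import Relation.Binary.Definitions using (DecidableEquality; tri<; tri≈; tri>)
open import Relation.Binary.PropositionalEquality hiding ([_])
open import Data.List.Relation.Binary.Permutation.Setoid.Properties (setoid ℕ) using (Unique-resp-↭)
open import Relation.Nullary using (¬_; Dec; yes; no; ¬?; contradiction)
open import Relation.Nullary.Decidable using (⌊_⌋; toWitness)

-- Duplicate-free lists

unique-∼set⇒length≡ : {A : Set} {xs ys : List A} → Unique xs → Unique ys → xs ∼[ set ] ys →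
                       length xs ≡ length ys
unique-∼set⇒length≡ uxs uys xs∼ys = ↭-length (∼bag⇒↭ (unique∧set⇒bag uxs uys xs∼ys))

module _ {A : Set} (_≟_ : DecidableEquality A) where

  open import Data.List.Membership.DecPropositional _≟_ using (_∈?_)

  unique-⊆⇒↭ : ∀ {xs ys : List A} → Unique xs → Unique ys → xs ⊆ ys → length xs ≡ length ys →
               xs ↭ ys
  unique-⊆⇒↭ {xs} {ys} uxs uys xs⊆ys same-length = ∼bag⇒↭ (unique∧set⇒bag uxs uys xs∼ys)
    where
    ys∩xs : List A
    ys∩xs = filter (_∈? xs) ys
    xs∼ys∩xs : xs ∼[ set ] ys∩xs
    xs∼ys∩xs = mk⇔ (λ z∈xs → ∈-filter⁺ (_∈? xs) (xs⊆ys z∈xs) z∈xs)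
                   (λ z∈ → proj₂ (∈-filter⁻ (_∈? xs) {xs = ys} z∈))
    ys∩xs≡ys : ys∩xs ≡ ys
    ys∩xs≡ys = filter-complete (_∈? xs)
      (trans (sym (unique-∼set⇒length≡ uxs (Unique.filter⁺ (_∈? xs) uys) xs∼ys∩xs)) same-length)
    xs∼ys : xs ∼[ set ] ys
    xs∼ys = subst (xs ∼[ set ]_) ys∩xs≡ys xs∼ys∩xs

unique-++⇒disjoint : ∀ {A : Set} xs {ys : List A} {x} → Unique (xs ++ ys) → x ∈ xs → x ∉ ys
unique-++⇒disjoint (_ ∷ xs) (x≢ ∷ _) (here refl)  = All¬⇒¬Any (++⁻ʳ xs x≢)
unique-++⇒disjoint (_ ∷ xs) (_ ∷ u)  (there x∈xs) = unique-++⇒disjoint xs u x∈xs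

length-filterᵇ-++ : ∀ {A : Set} (p : A → Bool) xs ys →
                    length (filterᵇ p (xs ++ ys)) ≡ length (filterᵇ p xs) + length (filterᵇ p ys)
length-filterᵇ-++ p xs ys = trans (cong length (filter-++ (T? ∘ p) xs ys)) (length-++ (filterᵇ p xs))

-- Iterates and periods

module _ {A : Set} (f : A → A) where

  fold-shift : ∀ x k → fold (f x) f k ≡ fold x f (suc k)
  fold-shift x k = trans (sym (fold-+ x f k)) (cong (fold x f) (+-comm k 1))

  fold-fold : ∀ x a b → fold x (λ y → fold y f a) b ≡ fold x f (b * a)
  fold-fold x a zero    = refl
  fold-fold x a (suc b) = trans (cong (λ y → fold y f a) (fold-fold x a b)) (sym (fold-+ x f a))

  fixed-* : ∀ {x d} → fold x f d ≡ x → ∀ c → fold x f (c * d) ≡ x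
  fixed-* fix zero = refl
  fixed-* {x} {d} fix (suc c) = begin
    fold x f (d + c * d)        ≡⟨ fold-+ x f d ⟩
    fold (fold x f (c * d)) f d ≡⟨ cong (λ y → fold y f d) (fixed-* fix c) ⟩
    fold x f d                  ≡⟨ fix ⟩
    x                           ∎
    where open ≡-Reasoning

  fixed-∣ : ∀ {x d e} → d ∣ e → fold x f d ≡ x → fold x f e ≡ x
  fixed-∣ (divides c refl) fix = fixed-* fix c

  fixed-+⁻ : ∀ {x} d {e} → fold x f (d + e) ≡ x → fold x f e ≡ x → fold x f d ≡ x
  fixed-+⁻ {x} d {e} fix-d+e fix-e = begin
    fold x f d              ≡⟨ cong (λ y → fold y f d) fix-e ⟨
    fold (fold x f e) f d   ≡⟨ fold-+ x f d ⟨
    fold x f (d + e)        ≡⟨ fix-d+e ⟩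
    x                       ∎
    where open ≡-Reasoning

  fixed-gcd : ∀ {x j k d} → GCD j k d → fold x f j ≡ x → fold x f k ≡ x → fold x f d ≡ x
  fixed-gcd {x} {d = d} g fix-j fix-k with Bézout.identity g
  ... | Bézout.+- a b d+bk≡aj =
    fixed-+⁻ d (trans (cong (fold x f) d+bk≡aj) (fixed-* fix-j a)) (fixed-* fix-k b)
  ... | Bézout.-+ a b d+aj≡bk =
    fixed-+⁻ d (trans (cong (fold x f) d+aj≡bk) (fixed-* fix-k b)) (fixed-* fix-j a)

  fold-mod : ∀ {x q} .{{_ : NonZero q}} → fold x f q ≡ x → ∀ j → fold x f j ≡ fold x f (j % q)
  fold-mod {x} {q} fix j = begin
    fold x f j                            ≡⟨ cong (fold x f) (m≡m%n+[m/n]*n j q) ⟩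
    fold x f (j % q + j / q * q)          ≡⟨ fold-+ x f (j % q) ⟩
    fold (fold x f (j / q * q)) f (j % q) ≡⟨ cong (λ y → fold y f (j % q)) (fixed-* fix (j / q)) ⟩
    fold x f (j % q)                      ∎
    where open ≡-Reasoning

∣p^[1+m]⇒∣p^m : ∀ {p d} → Prime p → ∀ m → d ∣ p ^ suc m → d ≢ p ^ suc m → d ∣ p ^ m
∣p^[1+m]⇒∣p^m {p} {d} p-prime m d∣ d≢ with p ∣? d
... | no p∤d = coprime-divisor coprime d∣
  where
  coprime : Coprime d p
  coprime (i∣d , i∣p) with prime⇒irreducible p-prime i∣p
  ... | inj₁ i≡1  = i≡1
  ... | inj₂ refl = contradiction i∣d p∤d
... | yes (divides d′ refl) = cancel m d∣ d≢
  where
  instance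
    p≢0 : NonZero p
    p≢0 = prime⇒nonZero p-prime
  cancel : ∀ m → d′ * p ∣ p ^ suc m → d′ * p ≢ p ^ suc m → d′ * p ∣ p ^ m
  cancel m d∣ d≢ with *-cancelˡ-∣ p (subst (_∣ p * p ^ m) (*-comm d′ p) d∣)
  ... | d′∣p^m with m
  ...   | zero  = contradiction (trans (cong (_* p) (∣1⇒≡1 d′∣p^m)) (*-comm 1 p)) d≢
  ...   | suc k = subst (d′ * p ∣_) (*-comm (p ^ k) p) (*-monoˡ-∣ p (∣p^[1+m]⇒∣p^m p-prime k d′∣p^m
                    (λ d′≡ → d≢ (trans (cong (_* p) d′≡) (*-comm (p ^ suc k) p)))))

prime-power-period : ∀ {A : Set} (f : A → A) {p x} m → Prime p →
                     fold x f (p ^ suc m) ≡ x → fold x f (p ^ m) ≢ x →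
                     ∀ {j} → 0 < j → j < p ^ suc m → fold x f j ≢ x
prime-power-period f {p} {x} m p-prime fix-q unfixed {j} 0<j j<q fix-j =
  unfixed (fixed-∣ f (∣p^[1+m]⇒∣p^m p-prime m (GCD.gcd∣n g) d≢q) (fixed-gcd f g fix-j fix-q))
  where
  g : GCD j (p ^ suc m) (gcd j (p ^ suc m))
  g = gcd-GCD j (p ^ suc m)
  d≢q : gcd j (p ^ suc m) ≢ p ^ suc m
  d≢q = <⇒≢ (≤-<-trans (∣⇒≤ {{>-nonZero 0<j}} (GCD.gcd∣m g)) j<q)

-- Orbits of a free cyclic action

module Orbit {A : Set} (_≟_ : DecidableEquality A) (f : A → A) (q : ℕ) .{{_ : NonZero q}} where

  open import Data.List.Membership.DecPropositional _≟_ using (_∈?_)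

  record FreeAction (L : List A) : Set where
    field
      closed    : ∀ {x} → x ∈ L → f x ∈ L
      periodic  : ∀ {x} → x ∈ L → fold x f q ≡ x
      aperiodic : ∀ {x} → x ∈ L → ∀ {j} → 0 < j → j < q → fold x f j ≢ x

  orbit : A → List A
  orbit x = applyUpTo (fold x f) q

  ∈-orbit⁺ : ∀ {x} → fold x f q ≡ x → ∀ j → fold x f j ∈ orbit x
  ∈-orbit⁺ {x} fix j =
    subst (_∈ orbit x) (sym (fold-mod f fix j)) (∈-applyUpTo⁺ (fold x f) (m%n<n j q))

  ∈-orbit⁻ : ∀ {x y} → y ∈ orbit x → ∃ λ j → y ≡ fold x f j
  ∈-orbit⁻ y∈ with j , _ , y≡ ← ∈-applyUpTo⁻ _ y∈ = j , y≡

  _∉orbit?_ : ∀ y x → Dec (y ∉ orbit x)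
  y ∉orbit? x = ¬? (y ∈? orbit x)

  outside : A → List A → List A
  outside x = filter (_∉orbit? x)

  module _ {L : List A} (act : FreeAction L) where
    open FreeAction act

    fold-closed : ∀ {x} j → x ∈ L → fold x f j ∈ L
    fold-closed zero    x∈L = x∈L
    fold-closed (suc j) x∈L = closed (fold-closed j x∈L)

    orbit⊆ : ∀ {x y} → x ∈ L → y ∈ orbit x → y ∈ L
    orbit⊆ x∈L y∈ with j , refl ← ∈-orbit⁻ y∈ = fold-closed j x∈L

    orbit-unique : ∀ {x} → x ∈ L → Unique (orbit x)
    orbit-unique {x} x∈L = Unique.applyUpTo⁺₁ (fold x f) q pairwise-distinct
      where
      pairwise-distinct : ∀ {i j} → i < j → j < q → fold x f i ≢ fold x f j
      pairwise-distinct {i} {j} i<j j<q eq =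
        aperiodic (fold-closed i x∈L) (m<n⇒0<n∸m i<j) (≤-<-trans (m∸n≤m j i) j<q) (begin
          fold (fold x f i) f (j ∸ i) ≡⟨ fold-+ x f (j ∸ i) ⟨
          fold x f (j ∸ i + i)        ≡⟨ cong (fold x f) (m∸n+n≡m (<⇒≤ i<j)) ⟩
          fold x f j                  ≡⟨ eq ⟨
          fold x f i                  ∎)
        where open ≡-Reasoning

    outside-closed : ∀ {x y} → x ∈ L → y ∈ outside x L → f y ∈ outside x L
    outside-closed {x} {y} x∈L y∈ with y∈L , y∉orbit ← ∈-filter⁻ _ {xs = L} y∈ =
      ∈-filter⁺ _ (closed y∈L) fy∉orbit
      where
      fy∉orbit : f y ∉ orbit x
      fy∉orbit fy∈ with j , fy≡ ← ∈-orbit⁻ fy∈ =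
        y∉orbit (subst (_∈ orbit x) y≡ (∈-orbit⁺ (periodic x∈L) (pred q + j)))
        where
        y≡ : fold x f (pred q + j) ≡ y
        y≡ = begin
          fold x f (pred q + j)        ≡⟨ fold-+ x f (pred q) ⟩
          fold (fold x f j) f (pred q) ≡⟨ cong (λ z → fold z f (pred q)) fy≡ ⟨
          fold (f y) f (pred q)        ≡⟨ fold-shift f y (pred q) ⟩
          fold y f (suc (pred q))      ≡⟨ cong (fold y f) (suc-pred q) ⟩
          fold y f q                   ≡⟨ periodic y∈L ⟩
          y                            ∎
          where open ≡-Reasoning

    length-outside : ∀ {x} → x ∈ L → Unique L → length L ≡ q + length (outside x L)
    length-outside {x} x∈L uL = begin
      length L                                ≡⟨ unique-∼set⇒length≡ uL unique-split split ⟩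
      length (orbit x ++ outside x L)         ≡⟨ length-++ (orbit x) ⟩
      length (orbit x) + length (outside x L) ≡⟨ cong (_+ length (outside x L)) (length-applyUpTo _ q) ⟩
      q + length (outside x L)                ∎
      where
      open ≡-Reasoning
      unique-split : Unique (orbit x ++ outside x L)
      unique-split = Unique.++⁺ (orbit-unique x∈L) (Unique.filter⁺ (_∉orbit? x) uL)
        (λ (y∈orbit , y∈outside) → proj₂ (∈-filter⁻ _ {xs = L} y∈outside) y∈orbit)
      split : L ∼[ set ] (orbit x ++ outside x L)
      split {y} = mk⇔ to from
        where
        to : y ∈ L → y ∈ orbit x ++ outside x L
        to y∈L with y ∈? orbit x
        ... | yes y∈orbit = ∈-++⁺ˡ y∈orbit
        ... | no  y∉orbit = ∈-++⁺ʳ (orbit x) (∈-filter⁺ _ y∈L y∉orbit)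
        from : y ∈ orbit x ++ outside x L → y ∈ L
        from y∈ with ∈-++⁻ (orbit x) y∈
        ... | inj₁ y∈orbit   = orbit⊆ x∈L y∈orbit
        ... | inj₂ y∈outside = proj₁ (∈-filter⁻ _ {xs = L} y∈outside)

    outside-action : ∀ {x} → x ∈ L → FreeAction (outside x L)
    outside-action x∈L = record
      { closed    = outside-closed x∈L
      ; periodic  = periodic ∘ proj₁ ∘ ∈-filter⁻ _
      ; aperiodic = aperiodic ∘ proj₁ ∘ ∈-filter⁻ _
      }

  period∣length : ∀ {L} → Unique L → FreeAction L → q ∣ length L
  period∣length {L} = go L (<-wellFounded (length L))
    where
    go : ∀ L → Acc _<_ (length L) → Unique L → FreeAction L → q ∣ length L
    go []         _         _  _   = q ∣0
    go L@(x ∷ _) (acc rec) uL act =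
      subst (q ∣_) (sym split) (∣m∣n⇒∣m+n ∣-refl
        (go (outside x L) (rec shorter) (Unique.filter⁺ (_∉orbit? x) uL) (outside-action act x∈L)))
      where
      x∈L : x ∈ L
      x∈L = here refl
      split : length L ≡ q + length (outside x L)
      split = length-outside act x∈L uL
      shorter : length (outside x L) < length L
      shorter = subst (length (outside x L) <_) (sym split) (m<n+m _ (>-nonZero⁻¹ q))

-- Permutations as lists

fresh⇒All≢ : ∀ a as → T (not (any (a ≡ᵇ_) as)) → All (a ≢_) as
fresh⇒All≢ a []       _ = []
fresh⇒All≢ a (b ∷ bs) t with a ≡ᵇ b in eq
... | false = (λ { refl → subst T eq (≡⇒≡ᵇ a a refl) }) ∷ fresh⇒All≢ a bs t

All≢⇒fresh : ∀ a as → All (a ≢_) as → T (not (any (a ≡ᵇ_) as))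
All≢⇒fresh a []       []          = _
All≢⇒fresh a (b ∷ bs) (a≢b ∷ a≢bs) with a ≡ᵇ b in eq
... | true  = a≢b (≡ᵇ⇒≡ a b (subst T (sym eq) _))
... | false = All≢⇒fresh a bs a≢bs

distinct⇒unique : ∀ xs → T (distinct xs) → Unique xs
distinct⇒unique []       _ = []
distinct⇒unique (a ∷ as) t with fresh , rest ← Equivalence.to T-∧ t =
  fresh⇒All≢ a as fresh ∷ distinct⇒unique as rest

unique⇒distinct : ∀ {xs} → Unique xs → T (distinct xs)
unique⇒distinct []                = _
unique⇒distinct {a ∷ as} (a≢as ∷ u) =
  Equivalence.from T-∧ (All≢⇒fresh a as a≢as , unique⇒distinct u)

words-suc : ∀ N L → words N (suc L) ≡ cartesianProductWith (λ i w → toℕ i ∷ w) (allFin N) (words N L)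
words-suc N L = go (allFin N)
  where
  go : ∀ is → concatMap (λ i → map (toℕ i ∷_) (words N L)) is ≡
              cartesianProductWith (λ i w → toℕ i ∷ w) is (words N L)
  go []       = refl
  go (i ∷ is) = cong (map (toℕ i ∷_) (words N L) ++_) (go is)

words-unique : ∀ N L → Unique (words N L)
words-unique N zero    = [] ∷ []
words-unique N (suc L) rewrite words-suc N L =
  Unique.cartesianProductWith⁺ _ injective (Unique.allFin⁺ N) (words-unique N L)
  where
  injective : ∀ {i j : Fin N} {v w} → toℕ i ∷ v ≡ toℕ j ∷ w → i ≡ j × v ≡ w
  injective eq with i≡j , v≡w ← ∷-injective eq = toℕ-injective i≡j , v≡w

∈-words⁻ : ∀ N L {w} → w ∈ words N L → length w ≡ L × All (_< N) w
∈-words⁻ N zero    (here refl) = refl , []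
∈-words⁻ N (suc L) w∈ rewrite words-suc N L
  with i , v , _ , v∈ , refl ← ∈-cartesianProductWith⁻ _ (allFin N) (words N L) w∈
  with length≡ , bounded ← ∈-words⁻ N L v∈ = cong suc length≡ , (toℕ<n i ∷ bounded)

∈-words⁺ : ∀ N {w} → All (_< N) w → w ∈ words N (length w)
∈-words⁺ N []                 = here refl
∈-words⁺ N {a ∷ w} (a<N ∷ w<N) rewrite words-suc N (length w) =
  subst (λ b → b ∷ w ∈ _) (toℕ-fromℕ< a<N)
    (∈-cartesianProductWith⁺ (λ i v → toℕ i ∷ v) (∈-allFin (fromℕ< a<N)) (∈-words⁺ N w<N))

IsPerm : ℕ → List ℕ → Set
IsPerm N u = u ↭ upTo N

module IsPerm {N u} (u↭ : IsPerm N u) where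

  length≡ : length u ≡ N
  length≡ = trans (↭-length u↭) (length-upTo N)

  bounded : All (_< N) u
  bounded = All-resp-↭ (↭-sym u↭) (All.tabulate ∈-upTo⁻)

  unique : Unique u
  unique = Unique-resp-↭ (↭⇒↭ₛ (↭-sym u↭)) (Unique.upTo⁺ N)

∈-perms⁻ : ∀ N {u} → u ∈ perms N → IsPerm N u
∈-perms⁻ N {u} u∈
  with u∈words , distinct-u ← ∈-filter⁻ _ u∈
  with length≡ , bounded ← ∈-words⁻ N N u∈words =
  unique-⊆⇒↭ _≟_ (distinct⇒unique u distinct-u) (Unique.upTo⁺ N)
    (λ z∈u → ∈-upTo⁺ (All.lookup bounded z∈u)) (trans length≡ (sym (length-upTo N)))

∈-perms⁺ : ∀ N {u} → IsPerm N u → u ∈ perms N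
∈-perms⁺ N u↭ =
  ∈-filter⁺ _ (subst (λ L → _ ∈ words N L) length≡ (∈-words⁺ N bounded)) (unique⇒distinct unique)
  where open IsPerm u↭

perms-unique : ∀ N → Unique (perms N)
perms-unique N = Unique.filter⁺ _ (words-unique N N)

-- The cyclic shift

splitOn : ℕ → List ℕ → List ℕ × List ℕ
splitOn c []       = [] , []
splitOn c (a ∷ as) with a ≟ c
... | yes _ = [] , as
... | no  _ = Product.map₁ (a ∷_) (splitOn c as)

splitOn-∈ : ∀ c {u} → c ∈ u → u ≡ proj₁ (splitOn c u) ++ c ∷ proj₂ (splitOn c u)
splitOn-∈ c {a ∷ as} c∈ with a ≟ c | c∈
... | yes refl | _          = refl
... | no  a≢c  | here refl  = contradiction refl a≢c
... | no  _    | there c∈as = cong (a ∷_) (splitOn-∈ c c∈as)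

-- For u = α c β, adding 1 modulo c + 2 to the cyclic word α c β (c+1) gives
-- (α+1) (c+1) (β+1) 0, and rotating c + 1 to the end gives (β+1) 0 (α+1) (c+1).
cyclicShift : ℕ → List ℕ → List ℕ
cyclicShift c u = map suc (proj₂ (splitOn c u)) ++ 0 ∷ map suc (proj₁ (splitOn c u))

record MaxSplit (c : ℕ) (u : List ℕ) : Set where
  field
    before after : List ℕ
    u≡         : u ≡ before ++ c ∷ after
    cyclicShift≡     : cyclicShift c u ≡ map suc after ++ 0 ∷ map suc before
    rest↭      : before ++ after ↭ upTo c

  before<c : All (_< c) before
  before<c = ++⁻ˡ before (IsPerm.bounded rest↭)

  after<c : All (_< c) after
  after<c = ++⁻ʳ before (IsPerm.bounded rest↭)

  disjoint : ∀ {x} → x ∈ before → x ∉ after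
  disjoint = unique-++⇒disjoint before (IsPerm.unique rest↭)

  length-rest : length before + length after ≡ c
  length-rest = trans (sym (length-++ before)) (IsPerm.length≡ rest↭)

maxSplit : ∀ c {u} → IsPerm (suc c) u → MaxSplit c u
maxSplit c {u} u↭ = record
  { before = α ; after = β ; u≡ = u≡ ; cyclicShift≡ = refl
  ; rest↭ = subst (α ++ β ↭_) (++-identityʳ (upTo c))
              (drop-mid α (upTo c) (subst (_↭ upTo c ++ [ c ]) u≡ u↭′))
  }
  where
  α β : List ℕ
  α = proj₁ (splitOn c u)
  β = proj₂ (splitOn c u)
  u≡ : u ≡ α ++ c ∷ β
  u≡ = splitOn-∈ c (∈-resp-↭ (↭-sym u↭) (∈-upTo⁺ ≤-refl))
  u↭′ : u ↭ upTo c ++ [ c ]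
  u↭′ = subst (u ↭_) (sym (upTo-∷ʳ c)) u↭

shifted-↭ : ∀ {c} α β → α ++ β ↭ upTo c → map suc β ++ 0 ∷ map suc α ↭ upTo (suc c)
shifted-↭ {c} α β α++β↭ = begin
  map suc β ++ 0 ∷ map suc α  ↭⟨ shift 0 (map suc β) (map suc α) ⟩
  0 ∷ map suc β ++ map suc α  ↭⟨ prep 0 (++-comm (map suc β) (map suc α)) ⟩
  0 ∷ map suc α ++ map suc β  ≡⟨ cong (0 ∷_) (map-++ suc α β) ⟨
  0 ∷ map suc (α ++ β)        ↭⟨ prep 0 (map⁺ suc α++β↭) ⟩
  0 ∷ map suc (upTo c)        ≡⟨ cong (0 ∷_) (map-upTo suc c) ⟩
  upTo (suc c)                ∎
  where open PermutationReasoning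

cyclicShift-perm : ∀ c {u} → IsPerm (suc c) u → IsPerm (suc c) (cyclicShift c u)
cyclicShift-perm c u↭ = shifted-↭ before after rest↭
  where open MaxSplit (maxSplit c u↭)

<⇒<ᵇ≡true : ∀ {m n} → m < n → (m <ᵇ n) ≡ true
<⇒<ᵇ≡true m<n = Equivalence.to T-≡ (<⇒<ᵇ m<n)

≮⇒<ᵇ≡false : ∀ {m n} → ¬ m < n → (m <ᵇ n) ≡ false
≮⇒<ᵇ≡false {m} {n} m≮n with m <ᵇ n in eq
... | true  = contradiction (<ᵇ⇒< m n (subst T (sym eq) _)) m≮n
... | false = refl

isAscent : ℕ → ℕ → ℕ
isAscent x y = if x <ᵇ y then 1 else 0

ascents-++-∷ : ∀ xs y ys → ascents (xs ++ y ∷ ys) ≡ ascents (xs ++ [ y ]) + ascents (y ∷ ys)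
ascents-++-∷ []            y ys = refl
ascents-++-∷ (x ∷ [])      y ys = cong (_+ ascents (y ∷ ys)) (sym (+-identityʳ _))
ascents-++-∷ (x ∷ x′ ∷ xs) y ys =
  trans (cong (isAscent x x′ +_) (ascents-++-∷ (x′ ∷ xs) y ys)) (sym (+-assoc (isAscent x x′) _ _))

ascents-map-suc : ∀ xs → ascents (map suc xs) ≡ ascents xs
ascents-map-suc []           = refl
ascents-map-suc (x ∷ [])     = refl
ascents-map-suc (x ∷ y ∷ xs) = cong (isAscent x y +_) (ascents-map-suc (y ∷ xs))

ascents-∷-max : ∀ {y} xs → All (_< y) xs → ascents (y ∷ xs) ≡ ascents xs
ascents-∷-max []       _         = refl
ascents-∷-max (x ∷ xs) (x<y ∷ _) =
  cong (λ b → (if b then 1 else 0) + ascents (x ∷ xs)) (≮⇒<ᵇ≡false (<⇒≯ x<y))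

ascents-∷ʳ-zero : ∀ xs → ascents (map suc xs ++ [ 0 ]) ≡ ascents xs
ascents-∷ʳ-zero []           = refl
ascents-∷ʳ-zero (x ∷ [])     = refl
ascents-∷ʳ-zero (x ∷ y ∷ xs) = cong (isAscent x y +_) (ascents-∷ʳ-zero (y ∷ xs))

ascents-∷ʳ-max : ∀ {y} xs → All (_< y) xs → ascents (xs ++ [ y ]) ≡ ascents (0 ∷ map suc xs)
ascents-∷ʳ-max []            _                 = refl
ascents-∷ʳ-max (x ∷ [])      (x<y ∷ [])        = cong (λ b → (if b then 1 else 0) + 0) (<⇒<ᵇ≡true x<y)
ascents-∷ʳ-max (x ∷ x′ ∷ xs) (_ ∷ x′<y ∷ xs<y) =
  trans (cong (isAscent x x′ +_) (ascents-∷ʳ-max (x′ ∷ xs) (x′<y ∷ xs<y))) (+-suc _ _)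

ascents-shifted : ∀ {c} α β → All (_< c) α → All (_< c) β →
                ascents (map suc β ++ 0 ∷ map suc α) ≡ ascents (α ++ c ∷ β)
ascents-shifted {c} α β α<c β<c = begin
  ascents (map suc β ++ 0 ∷ map suc α)
    ≡⟨ ascents-++-∷ (map suc β) 0 (map suc α) ⟩
  ascents (map suc β ++ [ 0 ]) + ascents (0 ∷ map suc α)
    ≡⟨ cong₂ _+_ (ascents-∷ʳ-zero β) (sym (ascents-∷ʳ-max α α<c)) ⟩
  ascents β + ascents (α ++ [ c ])
    ≡⟨ +-comm (ascents β) _ ⟩
  ascents (α ++ [ c ]) + ascents β
    ≡⟨ cong (ascents (α ++ [ c ]) +_) (ascents-∷-max β β<c) ⟨
  ascents (α ++ [ c ]) + ascents (c ∷ β)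
    ≡⟨ ascents-++-∷ α c β ⟨
  ascents (α ++ c ∷ β)
    ∎
  where open ≡-Reasoning

below above : ℕ → List ℕ → ℕ
below x ys = length (filterᵇ (_<ᵇ x) ys)
above x ys = length (filterᵇ (x <ᵇ_) ys)

cross : List ℕ → List ℕ → ℕ
cross []       ys = 0
cross (x ∷ xs) ys = below x ys + cross xs ys

inversions-++ : ∀ xs ys → inversions (xs ++ ys) ≡ inversions xs + cross xs ys + inversions ys
inversions-++ []       ys = refl
inversions-++ (x ∷ xs) ys
  rewrite length-filterᵇ-++ (_<ᵇ x) xs ys | inversions-++ xs ys =
  rearrange (below x xs) (below x ys) (inversions xs) (cross xs ys) (inversions ys)
  where
  rearrange : ∀ a b i c j → a + b + (i + c + j) ≡ a + i + (b + c) + j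
  rearrange = solve-∀

below-map-suc : ∀ x ys → below (suc x) (map suc ys) ≡ below x ys
below-map-suc x []       = refl
below-map-suc x (y ∷ ys) with y <ᵇ x
... | true  = cong suc (below-map-suc x ys)
... | false = below-map-suc x ys

inversions-map-suc : ∀ xs → inversions (map suc xs) ≡ inversions xs
inversions-map-suc []       = refl
inversions-map-suc (x ∷ xs) = cong₂ _+_ (below-map-suc x xs) (inversions-map-suc xs)

cross-map-suc : ∀ xs ys → cross (map suc xs) (map suc ys) ≡ cross xs ys
cross-map-suc []       ys = refl
cross-map-suc (x ∷ xs) ys = cong₂ _+_ (below-map-suc x ys) (cross-map-suc xs ys)

cross-∷ʳ : ∀ xs y ys → cross xs (y ∷ ys) ≡ above y xs + cross xs ys
cross-∷ʳ []       y ys = refl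
cross-∷ʳ (x ∷ xs) y ys with y <ᵇ x
... | true  = cong suc (trans (cong (below x ys +_) (cross-∷ʳ xs y ys))
                              (x∙yz≈y∙xz (below x ys) (above y xs) (cross xs ys)))
... | false = trans (cong (below x ys +_) (cross-∷ʳ xs y ys))
                    (x∙yz≈y∙xz (below x ys) (above y xs) (cross xs ys))

below+above : ∀ x ys → x ∉ ys → below x ys + above x ys ≡ length ys
below+above x []       _   = refl
below+above x (y ∷ ys) x∉ with <-cmp y x
... | tri< y<x _ _ rewrite <⇒<ᵇ≡true y<x | ≮⇒<ᵇ≡false (<⇒≯ y<x) =
  cong suc (below+above x ys (x∉ ∘ there))
... | tri≈ _ refl _ = contradiction (here refl) x∉
... | tri> _ _ x<y rewrite ≮⇒<ᵇ≡false (<⇒≯ x<y) | <⇒<ᵇ≡true x<y =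
  trans (+-suc _ _) (cong suc (below+above x ys (x∉ ∘ there)))

cross-sym : ∀ xs ys → (∀ {x} → x ∈ xs → x ∉ ys) →
            cross xs ys + cross ys xs ≡ length xs * length ys
cross-sym []       ys _        = cross-[]ʳ ys
  where
  cross-[]ʳ : ∀ ys → cross ys [] ≡ 0
  cross-[]ʳ []       = refl
  cross-[]ʳ (_ ∷ ys) = cross-[]ʳ ys
cross-sym (x ∷ xs) ys disjoint = begin
  (below x ys + cross xs ys) + cross ys (x ∷ xs)
    ≡⟨ cong (below x ys + cross xs ys +_) (cross-∷ʳ ys x xs) ⟩
  (below x ys + cross xs ys) + (above x ys + cross ys xs)
    ≡⟨ interchange (below x ys) (cross xs ys) _ _ ⟩
  (below x ys + above x ys) + (cross xs ys + cross ys xs)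
    ≡⟨ cong₂ _+_ (below+above x ys (disjoint (here refl))) (cross-sym xs ys (disjoint ∘ there)) ⟩
  length ys + length xs * length ys
    ∎
  where open ≡-Reasoning

below-all : ∀ {x} ys → All (_< x) ys → below x ys ≡ length ys
below-all {x} ys ys<x = cong length (filter-all (T? ∘ (_<ᵇ x)) (All.map <⇒<ᵇ ys<x))

above-none : ∀ {x} ys → All (_< x) ys → above x ys ≡ 0
above-none {x} ys ys<x =
  cong length (filter-none (T? ∘ (x <ᵇ_)) (All.map (λ y<x x<y → <⇒≯ y<x (<ᵇ⇒< x _ x<y)) ys<x))

below-zero : ∀ ys → below 0 ys ≡ 0
below-zero []       = refl
below-zero (_ ∷ ys) = below-zero ys

above-zero : ∀ ys → above 0 (map suc ys) ≡ length ys
above-zero []       = refl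
above-zero (_ ∷ ys) = cong suc (above-zero ys)

inversions-around-max : ∀ {c} α β → All (_< c) α → All (_< c) β →
                       inversions (α ++ c ∷ β) ≡ inversions α + inversions β + length β + cross α β
inversions-around-max {c} α β α<c β<c = begin
  inversions (α ++ c ∷ β)
    ≡⟨ inversions-++ α (c ∷ β) ⟩
  inversions α + cross α (c ∷ β) + (below c β + inversions β)
    ≡⟨ cong₂ (λ a b → inversions α + a + (b + inversions β))
             (trans (cross-∷ʳ α c β) (cong (_+ cross α β) (above-none α α<c))) (below-all β β<c) ⟩
  inversions α + cross α β + (length β + inversions β)
    ≡⟨ rearrange (inversions α) (cross α β) (length β) (inversions β) ⟩
  inversions α + inversions β + length β + cross α β
    ∎
  where
  open ≡-Reasoning
  rearrange : ∀ i x l j → i + x + (l + j) ≡ i + j + l + x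
  rearrange = solve-∀

inversions-shifted : ∀ α β →
  inversions (map suc β ++ 0 ∷ map suc α) ≡ inversions α + inversions β + length β + cross β α
inversions-shifted α β = begin
  inversions (map suc β ++ 0 ∷ map suc α)
    ≡⟨ inversions-++ (map suc β) (0 ∷ map suc α) ⟩
  inversions (map suc β) + cross (map suc β) (0 ∷ map suc α) +
    (below 0 (map suc α) + inversions (map suc α))
    ≡⟨ cong₂ (λ a b → inversions (map suc β) + a + b)
             (trans (cross-∷ʳ (map suc β) 0 (map suc α)) (cong₂ _+_ (above-zero β) (cross-map-suc β α)))
             (cong₂ _+_ (below-zero (map suc α)) (inversions-map-suc α)) ⟩
  inversions (map suc β) + (length β + cross β α) + inversions α
    ≡⟨ cong (λ i → i + (length β + cross β α) + inversions α) (inversions-map-suc β) ⟩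
  inversions β + (length β + cross β α) + inversions α
    ≡⟨ rearrange (inversions β) (length β) (cross β α) (inversions α) ⟩
  inversions α + inversions β + length β + cross β α
    ∎
  where
  open ≡-Reasoning
  rearrange : ∀ j l x i → j + (l + x) + i ≡ i + j + l + x
  rearrange = solve-∀

odd-sum⇒even-product : ∀ a b t → a + b ≡ suc (t * 2) → 2 ∣ a * b
odd-sum⇒even-product zero          b t       _  = divides 0 refl
odd-sum⇒even-product (suc zero)    b t       eq = divides t (trans (+-identityʳ b) (suc-injective eq))
odd-sum⇒even-product (suc (suc a)) b (suc t) eq
  with divides s ab≡s*2 ← odd-sum⇒even-product a b t (suc-injective (suc-injective eq)) =
  divides (b + s) (trans (cong (λ x → b + (b + x)) ab≡s*2) (double b s))
  where
  double : ∀ b s → b + (b + s * 2) ≡ (b + s) * 2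
  double = solve-∀

[x+a]%2≡[x+b]%2 : ∀ x a b → 2 ∣ a + b → (x + a) % 2 ≡ (x + b) % 2
[x+a]%2≡[x+b]%2 x a b (divides s a+b≡s*2) = begin
  (x + a) % 2            ≡⟨ [m+kn]%n≡m%n (x + a) b 2 ⟨
  (x + a + b * 2) % 2    ≡⟨ cong (_% 2) (trans (regroup x a b) (cong (x + b +_) a+b≡s*2)) ⟩
  (x + b + s * 2) % 2    ≡⟨ [m+kn]%n≡m%n (x + b) s 2 ⟩
  (x + b) % 2            ∎
  where
  open ≡-Reasoning
  regroup : ∀ x a b → x + a + b * 2 ≡ x + b + (a + b)
  regroup = solve-∀

-- Apart from the pairs between α and β, the inversions of α c β and of (β+1) 0 (α+1)
-- correspond; those pairs contribute cross α β resp. cross β α, which add up to |α| |β|,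
-- an even number as |α| + |β| = c is odd.
evenInv-cyclicShift : ∀ {c u t} → c ≡ suc (t * 2) → IsPerm (suc c) u →
                      evenInv (cyclicShift c u) ≡ evenInv u
evenInv-cyclicShift {c} {u} {t} c-odd u↭ = cong (_≡ᵇ 0) (begin
  inversions (cyclicShift c u) % 2            ≡⟨ cong (λ w → inversions w % 2) cyclicShift≡ ⟩
  inversions (map suc β ++ 0 ∷ map suc α) % 2 ≡⟨ cong (_% 2) (inversions-shifted α β) ⟩
  (X + cross β α) % 2                         ≡⟨ [x+a]%2≡[x+b]%2 X _ _ crosses-even ⟩
  (X + cross α β) % 2                         ≡⟨ cong (_% 2) (inversions-around-max α β before<c after<c) ⟨
  inversions (α ++ c ∷ β) % 2                 ≡⟨ cong (λ w → inversions w % 2) u≡ ⟨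
  inversions u % 2                            ∎)
  where
  open ≡-Reasoning
  open MaxSplit (maxSplit c u↭) renaming (before to α; after to β)
  X : ℕ
  X = inversions α + inversions β + length β
  crosses-even : 2 ∣ cross β α + cross α β
  crosses-even = subst (2 ∣_) (sym (cross-sym β α (λ b∈β b∈α → disjoint b∈α b∈β)))
    (odd-sum⇒even-product (length β) (length α) t
      (trans (+-comm (length β) _) (trans length-rest c-odd)))

ascents-cyclicShift : ∀ c {u} → IsPerm (suc c) u → ascents (cyclicShift c u) ≡ ascents u
ascents-cyclicShift c {u} u↭ = begin
  ascents (cyclicShift c u)                  ≡⟨ cong ascents cyclicShift≡ ⟩
  ascents (map suc after ++ 0 ∷ map suc before) ≡⟨ ascents-shifted before after before<c after<c ⟩
  ascents (before ++ c ∷ after)               ≡⟨ cong ascents u≡ ⟨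
  ascents u                                   ∎
  where
  open ≡-Reasoning
  open MaxSplit (maxSplit c u↭)

-- Cyclic words

at : List ℕ → ℕ → ℕ
at []       _       = 0
at (x ∷ xs) zero    = x
at (x ∷ xs) (suc i) = at xs i

at-++ˡ : ∀ xs {ys} {i} → i < length xs → at (xs ++ ys) i ≡ at xs i
at-++ˡ (x ∷ xs) {i = zero}  _         = refl
at-++ˡ (x ∷ xs) {i = suc i} (s≤s i<n) = at-++ˡ xs i<n

at-++ʳ : ∀ xs {ys} j → at (xs ++ ys) (length xs + j) ≡ at ys j
at-++ʳ []       j = refl
at-++ʳ (x ∷ xs) j = at-++ʳ xs j

at-map : ∀ f xs {i} → i < length xs → at (map f xs) i ≡ f (at xs i)
at-map f (x ∷ xs) {zero}  _         = refl
at-map f (x ∷ xs) {suc i} (s≤s i<n) = at-map f xs i<n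

at-∈ : ∀ xs {i} → i < length xs → at xs i ∈ xs
at-∈ (x ∷ xs) {zero}  _         = here refl
at-∈ (x ∷ xs) {suc i} (s≤s i<n) = there (at-∈ xs i<n)

at-injective : ∀ {xs} → Unique xs → ∀ {i j} → i < length xs → j < length xs → at xs i ≡ at xs j → i ≡ j
at-injective {x ∷ xs} (x∉ ∷ u) {zero}  {zero}  _         _         _  = refl
at-injective {x ∷ xs} (x∉ ∷ u) {zero}  {suc j} _         (s≤s j<n) eq =
  contradiction (subst (_∈ xs) (sym eq) (at-∈ xs j<n)) (All¬⇒¬Any x∉)
at-injective {x ∷ xs} (x∉ ∷ u) {suc i} {zero}  (s≤s i<n) _         eq =
  contradiction (subst (_∈ xs) eq (at-∈ xs i<n)) (All¬⇒¬Any x∉)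
at-injective {x ∷ xs} (x∉ ∷ u) {suc i} {suc j} (s≤s i<n) (s≤s j<n) eq = cong suc (at-injective u i<n j<n eq)

at-ext : ∀ xs ys → length xs ≡ length ys → (∀ {i} → i < length xs → at xs i ≡ at ys i) → xs ≡ ys
at-ext []       []       _   _  = refl
at-ext (x ∷ xs) (y ∷ ys) len eq =
  cong₂ _∷_ (eq (s≤s z≤n)) (at-ext xs ys (suc-injective len) (eq ∘′ s≤s))

∑ : ℕ → (ℕ → ℕ) → ℕ
∑ zero    f = 0
∑ (suc L) f = ∑ L f + f L

∑-cong : ∀ L {f g} → (∀ {i} → i < L → f i ≡ g i) → ∑ L f ≡ ∑ L g
∑-cong zero    _   = refl
∑-cong (suc L) f≗g = cong₂ _+_ (∑-cong L (f≗g ∘′ m<n⇒m<1+n)) (f≗g ≤-refl)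

∑-+ : ∀ a b f → ∑ (a + b) f ≡ ∑ a f + ∑ b (λ i → f (a + i))
∑-+ a zero    f = trans (cong (λ L → ∑ L f) (+-identityʳ a)) (sym (+-identityʳ _))
∑-+ a (suc b) f = begin
  ∑ (a + suc b) f                                        ≡⟨ cong (λ L → ∑ L f) (+-suc a b) ⟩
  ∑ (a + b) f + f (a + b)                                ≡⟨ cong (_+ f (a + b)) (∑-+ a b f) ⟩
  ∑ a f + ∑ b (λ i → f (a + i)) + f (a + b)              ≡⟨ +-assoc (∑ a f) _ _ ⟩
  ∑ a f + (∑ b (λ i → f (a + i)) + f (a + b))            ∎
  where open ≡-Reasoning

∑-periodic : ∀ {f} a → (∀ i → f (i + a) ≡ f i) → ∀ k → ∑ (k * a) f ≡ k * ∑ a f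
∑-periodic a per zero    = refl
∑-periodic {f} a per (suc k) = begin
  ∑ (a + k * a) f                          ≡⟨ ∑-+ a (k * a) f ⟩
  ∑ a f + ∑ (k * a) (λ i → f (a + i))      ≡⟨ cong (∑ a f +_) (∑-cong (k * a) λ {i} _ → per′ i) ⟩
  ∑ a f + ∑ (k * a) f                      ≡⟨ cong (∑ a f +_) (∑-periodic a per k) ⟩
  ∑ a f + k * ∑ a f                        ∎
  where
  open ≡-Reasoning
  per′ : ∀ i → f (a + i) ≡ f i
  per′ i = trans (cong f (+-comm a i)) (per i)

module Mod (n : ℕ) .{{_ : NonZero n}} where

  %-absorbˡ : ∀ a b → (a % n + b) % n ≡ (a + b) % n
  %-absorbˡ a b = begin
    (a % n + b) % n           ≡⟨ %-distribˡ-+ (a % n) b n ⟩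
    (a % n % n + b % n) % n   ≡⟨ cong (λ r → (r + b % n) % n) (m%n%n≡m%n a n) ⟩
    (a % n + b % n) % n       ≡⟨ %-distribˡ-+ a b n ⟨
    (a + b) % n               ∎
    where open ≡-Reasoning

  private
    undo : ∀ x y → (x + y + (n ∸ x % n)) % n ≡ y % n
    undo x y = begin
      (x + y + (n ∸ x % n)) % n
        ≡⟨ cong (λ z → (z + y + (n ∸ x % n)) % n) (m≡m%n+[m/n]*n x n) ⟩
      (x % n + x / n * n + y + (n ∸ x % n)) % n
        ≡⟨ cong (_% n) (regroup (x % n) (x / n * n) y (n ∸ x % n)) ⟩
      (y + x / n * n + (x % n + (n ∸ x % n))) % n
        ≡⟨ cong (λ z → (y + x / n * n + z) % n) (m+[n∸m]≡n (m%n≤n x n)) ⟩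
      (y + x / n * n + n) % n
        ≡⟨ [m+n]%n≡m%n (y + x / n * n) n ⟩
      (y + x / n * n) % n
        ≡⟨ [m+kn]%n≡m%n y (x / n) n ⟩
      y % n
        ∎
      where
      open ≡-Reasoning
      regroup : ∀ r q y c → r + q + y + c ≡ y + q + (r + c)
      regroup = solve-∀

  +-cancelˡ-% : ∀ x {a b} → (x + a) % n ≡ (x + b) % n → a % n ≡ b % n
  +-cancelˡ-% x {a} {b} eq = begin
    a % n                           ≡⟨ undo x a ⟨
    (x + a + (n ∸ x % n)) % n       ≡⟨ %-absorbˡ (x + a) _ ⟨
    ((x + a) % n + (n ∸ x % n)) % n ≡⟨ cong (λ r → (r + (n ∸ x % n)) % n) eq ⟩
    ((x + b) % n + (n ∸ x % n)) % n ≡⟨ %-absorbˡ (x + b) _ ⟩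
    (x + b + (n ∸ x % n)) % n       ≡⟨ undo x b ⟩
    b % n                           ∎
    where open ≡-Reasoning

  +-congˡ-% : ∀ x {a b} → a % n ≡ b % n → (x + a) % n ≡ (x + b) % n
  +-congˡ-% x {a} {b} eq = begin
    (x + a) % n             ≡⟨ %-distribˡ-+ x a n ⟩
    (x % n + a % n) % n     ≡⟨ cong (λ r → (x % n + r) % n) eq ⟩
    (x % n + b % n) % n     ≡⟨ %-distribˡ-+ x b n ⟨
    (x + b) % n             ∎
    where open ≡-Reasoning

  +-cancelˡ-%-< : ∀ x {a b} → a < n → b < n → (x + a) % n ≡ (x + b) % n → a ≡ b
  +-cancelˡ-%-< x a<n b<n eq = trans (sym (m<n⇒m%n≡m a<n)) (trans (+-cancelˡ-% x eq) (m<n⇒m%n≡m b<n))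

  up : ℕ → ℕ → ℕ
  up x y = if y <ᵇ x then n + y ∸ x else y ∸ x

  up-spec : ∀ {x} y → x < n → x + up x y ≡ y + isAscent y x * n
  up-spec {x} y x<n with y <ᵇ x in eq
  ... | true  = trans (m+[n∸m]≡n (≤-trans (<⇒≤ x<n) (m≤m+n n y)))
                      (trans (+-comm n y) (cong (y +_) (sym (+-identityʳ n))))
  ... | false = trans (m+[n∸m]≡n {x} (≮⇒≥ (λ y<x → subst T eq (<⇒<ᵇ y<x)))) (sym (+-identityʳ y))

  up<n : ∀ {x y} → x < n → y < n → up x y < n
  up<n {x} {y} x<n y<n with y <ᵇ x in eq | up-spec y x<n
  ... | true  | spec = +-cancelˡ-< x _ _ (subst (_< x + n) (sym (trans spec (cong (y +_) (+-identityʳ n))))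
                         (+-monoˡ-< n (<ᵇ⇒< y x (subst T (sym eq) _))))
  ... | false | spec = ≤-<-trans (m≤n+m _ x) (subst (_< n) (sym (trans spec (+-identityʳ y))) y<n)

  up-shift : ∀ {x y} → x < n → y < n → ∀ s → up ((x + s) % n) ((y + s) % n) ≡ up x y
  up-shift {x} {y} x<n y<n s = +-cancelˡ-%-< x′ (up<n x′<n (m%n<n (y + s) n)) (up<n x<n y<n) (begin
    (x′ + up x′ y′) % n         ≡⟨ cong (_% n) (up-spec y′ x′<n) ⟩
    (y′ + isAscent y′ x′ * n) % n ≡⟨ [m+kn]%n≡m%n y′ (isAscent y′ x′) n ⟩
    y′ % n                      ≡⟨ m%n%n≡m%n (y + s) n ⟩
    (y + s) % n                 ≡⟨ [m+kn]%n≡m%n (y + s) (isAscent y x) n ⟨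
    (y + s + isAscent y x * n) % n ≡⟨ cong (_% n) (regroup y (isAscent y x * n) s) ⟩
    (y + isAscent y x * n + s) % n ≡⟨ cong (λ z → (z + s) % n) (up-spec y x<n) ⟨
    (x + up x y + s) % n        ≡⟨ cong (_% n) (regroup x (up x y) s) ⟨
    (x + s + up x y) % n        ≡⟨ %-absorbˡ (x + s) (up x y) ⟨
    (x′ + up x y) % n           ∎)
    where
    open ≡-Reasoning
    x′ y′ : ℕ
    x′ = (x + s) % n
    y′ = (y + s) % n
    x′<n : x′ < n
    x′<n = m%n<n (x + s) n
    regroup : ∀ a b c → a + c + b ≡ a + b + c
    regroup = solve-∀

  telescope : ∀ (w : ℕ → ℕ) → (∀ i → w i < n) → ∀ L →
              w L + ∑ L (λ i → up (w (suc i)) (w i)) ≡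
              w 0 + ∑ L (λ i → isAscent (w i) (w (suc i))) * n
  telescope w w<n zero    = cong (w 0 +_) (sym (*-zeroˡ n))
  telescope w w<n (suc L) = begin
    w (suc L) + (S + s)         ≡⟨ regroup (w (suc L)) S s ⟩
    S + (w (suc L) + s)         ≡⟨ cong (S +_) (up-spec (w L) (w<n (suc L))) ⟩
    S + (w L + a * n)           ≡⟨ regroup′ S (w L) (a * n) ⟩
    (w L + S) + a * n           ≡⟨ cong (_+ a * n) (telescope w w<n L) ⟩
    w 0 + A * n + a * n         ≡⟨ regroup″ (w 0) A a n ⟩
    w 0 + (A + a) * n           ∎
    where
    open ≡-Reasoning
    S s A a : ℕ
    S = ∑ L (λ i → up (w (suc i)) (w i))
    s = up (w (suc L)) (w L)
    A = ∑ L (λ i → isAscent (w i) (w (suc i)))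
    a = isAscent (w L) (w (suc L))
    regroup : ∀ x S s → x + (S + s) ≡ S + (x + s)
    regroup = solve-∀
    regroup′ : ∀ S x y → S + (x + y) ≡ x + S + y
    regroup′ = solve-∀
    regroup″ : ∀ w A a n → w + A * n + a * n ≡ w + (A + a) * n
    regroup″ = solve-∀

  at-rotate : ∀ xs ys → length xs + length ys ≡ n →
              ∀ i → at (ys ++ xs) (i % n) ≡ at (xs ++ ys) ((i + length xs) % n)
  at-rotate xs ys len i =
    trans (rotated (i % n) (m%n<n i n)) (cong (at (xs ++ ys)) (%-absorbˡ i (length xs)))
    where
    rotated : ∀ j → j < n → at (ys ++ xs) j ≡ at (xs ++ ys) ((j + length xs) % n)
    rotated j j<n with j <? length ys
    ... | yes j<ys = begin
      at (ys ++ xs) j                   ≡⟨ at-++ˡ ys j<ys ⟩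
      at ys j                           ≡⟨ at-++ʳ xs j ⟨
      at (xs ++ ys) (length xs + j)     ≡⟨ cong (at (xs ++ ys)) (trans (m<n⇒m%n≡m j+xs<n) (+-comm j _)) ⟨
      at (xs ++ ys) ((j + length xs) % n) ∎
      where
      open ≡-Reasoning
      j+xs<n : j + length xs < n
      j+xs<n = subst (j + length xs <_) (trans (+-comm (length ys) _) len) (+-monoˡ-< (length xs) j<ys)
    ... | no j≮ys = begin
      at (ys ++ xs) j                   ≡⟨ cong (at (ys ++ xs)) ys+t≡j ⟨
      at (ys ++ xs) (length ys + t)     ≡⟨ at-++ʳ ys t ⟩
      at xs t                           ≡⟨ at-++ˡ xs t<xs ⟨
      at (xs ++ ys) t                   ≡⟨ cong (at (xs ++ ys)) (m<n⇒m%n≡m t<n) ⟨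
      at (xs ++ ys) (t % n)             ≡⟨ cong (at (xs ++ ys)) ([m+n]%n≡m%n t n) ⟨
      at (xs ++ ys) ((t + n) % n)       ≡⟨ cong (λ k → at (xs ++ ys) (k % n)) j+xs≡t+n ⟨
      at (xs ++ ys) ((j + length xs) % n) ∎
      where
      open ≡-Reasoning
      t : ℕ
      t = j ∸ length ys
      ys+t≡j : length ys + t ≡ j
      ys+t≡j = m+[n∸m]≡n (≮⇒≥ j≮ys)
      t<xs : t < length xs
      t<xs = +-cancelˡ-< (length ys) _ _
               (subst₂ _<_ (sym ys+t≡j) (sym (trans (+-comm (length ys) _) len)) j<n)
      t<n : t < n
      t<n = <-≤-trans t<xs (subst (length xs ≤_) len (m≤m+n _ _))
      j+xs≡t+n : j + length xs ≡ t + n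
      j+xs≡t+n = begin
        j + length xs                    ≡⟨ cong (_+ length xs) ys+t≡j ⟨
        length ys + t + length xs        ≡⟨ regroup (length ys) t (length xs) ⟩
        t + (length xs + length ys)      ≡⟨ cong (t +_) len ⟩
        t + n                            ∎
        where
        regroup : ∀ a b c → a + b + c ≡ b + (c + a)
        regroup = solve-∀

  record CyclicWord (w : ℕ → ℕ) : Set where
    field
      bounded   : ∀ i → w i < n
      periodic  : ∀ i → w (i + n) ≡ w i
      injective : ∀ {i j} → w i ≡ w j → i % n ≡ j % n

    ascent : ℕ → ℕ
    ascent i = isAscent (w i) (w (suc i))

    cyclicAscents : ℕ
    cyclicAscents = ∑ n ascent

    -- gap i is w i - w (i+1) at a descent and n more than that at an ascent, so the
    -- gaps around the cycle add up to n times the number of cyclic ascents.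
    gap : ℕ → ℕ
    gap i = up (w (suc i)) (w i)

    ∑-gap : ∑ n gap ≡ cyclicAscents * n
    ∑-gap = +-cancelˡ-≡ (w 0) _ _
      (trans (cong (_+ ∑ n gap) (sym (periodic 0))) (telescope w bounded n))

  module _ {w} (cw : CyclicWord w) {r M} (symmetry : ∀ i → w i ≡ (w (i + r) + M) % n) where
    open CyclicWord cw

    gap-shift : ∀ i → gap (i + r) ≡ gap i
    gap-shift i = sym (trans (cong₂ up (symmetry (suc i)) (symmetry i))
                             (up-shift (bounded (suc i + r)) (bounded (i + r)) M))

    ∑-gap-r : ∑ r gap ≡ r * cyclicAscents
    ∑-gap-r = *-cancelˡ-≡ _ _ n (begin
      n * ∑ r gap              ≡⟨ ∑-periodic r gap-shift n ⟨
      ∑ (n * r) gap            ≡⟨ cong (λ L → ∑ L gap) (*-comm n r) ⟩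
      ∑ (r * n) gap            ≡⟨ ∑-periodic n (λ i → cong₂ up (periodic (suc i)) (periodic i)) r ⟩
      r * ∑ n gap              ≡⟨ cong (r *_) ∑-gap ⟩
      r * (cyclicAscents * n)  ≡⟨ regroup n r cyclicAscents ⟩
      n * (r * cyclicAscents)  ∎)
      where
      open ≡-Reasoning
      regroup : ∀ n r a → r * (a * n) ≡ n * (r * a)
      regroup = solve-∀

    symmetry-* : ∀ k i → w i ≡ (w (i + k * r) + k * M) % n
    symmetry-* zero    i = sym (begin
      (w (i + 0) + 0) % n   ≡⟨ cong (λ j → (w j + 0) % n) (+-identityʳ i) ⟩
      (w i + 0) % n         ≡⟨ cong (_% n) (+-identityʳ (w i)) ⟩
      w i % n               ≡⟨ m<n⇒m%n≡m (bounded i) ⟩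
      w i                   ∎)
      where open ≡-Reasoning
    symmetry-* (suc k) i = begin
      w i                                      ≡⟨ symmetry-* k i ⟩
      (w (i + k * r) + k * M) % n              ≡⟨ cong (λ x → (x + k * M) % n) (symmetry (i + k * r)) ⟩
      ((w (i + k * r + r) + M) % n + k * M) % n ≡⟨ %-absorbˡ (w (i + k * r + r) + M) (k * M) ⟩
      (w (i + k * r + r) + M + k * M) % n      ≡⟨ cong (_% n) (+-assoc (w (i + k * r + r)) M (k * M)) ⟩
      (w (i + k * r + r) + (M + k * M)) % n    ≡⟨ cong (λ j → (w j + (M + k * M)) % n) (regroup i (k * r) r) ⟩
      (w (i + (r + k * r)) + (M + k * M)) % n  ∎
      where
      open ≡-Reasoning
      regroup : ∀ i kr r → i + kr + r ≡ i + (r + kr)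
      regroup = solve-∀

    n∣p*r : ∀ p → p * M ≡ n → n ∣ p * r
    n∣p*r p pM≡n = m%n≡0⇒n∣m (p * r) n
      (sym (trans (sym (m<n⇒m%n≡m (>-nonZero⁻¹ n))) (injective (begin
      w 0                        ≡⟨ symmetry-* p 0 ⟩
      (w (p * r) + p * M) % n    ≡⟨ cong (λ m → (w (p * r) + m) % n) pM≡n ⟩
      (w (p * r) + n) % n        ≡⟨ [m+n]%n≡m%n (w (p * r)) n ⟩
      w (p * r) % n              ≡⟨ m<n⇒m%n≡m (bounded (p * r)) ⟩
      w (p * r)                  ∎))))
      where open ≡-Reasoning

    n∣∑-gap-r : ∀ p → p * M ≡ n → p ∣ cyclicAscents → n ∣ ∑ r gap
    n∣∑-gap-r p pM≡n (divides a A≡a*p) =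
      subst (n ∣_) (sym (trans ∑-gap-r (trans (cong (r *_) A≡a*p) (regroup r a p))))
        (∣n⇒∣m*n a (n∣p*r p pM≡n))
      where
      regroup : ∀ r a p → r * (a * p) ≡ a * (p * r)
      regroup = solve-∀

    w0≡wr : ∀ p → p * M ≡ n → p ∣ cyclicAscents → w 0 ≡ w r
    w0≡wr p pM≡n p∣ with divides q ∑≡q*n ← n∣∑-gap-r p pM≡n p∣ = begin
      w 0                          ≡⟨ m<n⇒m%n≡m (bounded 0) ⟨
      w 0 % n                      ≡⟨ [m+kn]%n≡m%n (w 0) (∑ r ascent) n ⟨
      (w 0 + ∑ r ascent * n) % n   ≡⟨ cong (_% n) (telescope w bounded r) ⟨
      (w r + ∑ r gap) % n          ≡⟨ cong (λ s → (w r + s) % n) ∑≡q*n ⟩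
      (w r + q * n) % n            ≡⟨ [m+kn]%n≡m%n (w r) q n ⟩
      w r % n                      ≡⟨ m<n⇒m%n≡m (bounded r) ⟩
      w r                          ∎
      where open ≡-Reasoning

    symmetry⇒∤cyclicAscents : ∀ {p} → 1 < p → p * M ≡ n → ¬ p ∣ cyclicAscents
    symmetry⇒∤cyclicAscents {p} 1<p pM≡n p∣ = M≢0 (+-cancelˡ-%-< (w r) (>-nonZero⁻¹ n) M<n (begin
      (w r + 0) % n   ≡⟨ cong (_% n) (+-identityʳ (w r)) ⟩
      w r % n         ≡⟨ m<n⇒m%n≡m (bounded r) ⟩
      w r             ≡⟨ w0≡wr p pM≡n p∣ ⟨
      w 0             ≡⟨ symmetry 0 ⟩
      (w r + M) % n   ∎))
      where
      open ≡-Reasoning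
      M≢0 : 0 ≢ M
      M≢0 refl = <⇒≢ (>-nonZero⁻¹ n) (trans (sym (*-zeroʳ p)) pM≡n)
      M<n : M < n
      M<n = subst (M <_) (trans (*-comm M p) pM≡n) (m<m*n M p {{≢-nonZero (M≢0 ∘′ sym)}} 1<p)

-- The cyclic word of a permutation

ascents-∑ : ∀ xs → ascents xs ≡ ∑ (length xs ∸ 1) (λ i → isAscent (at xs i) (at xs (suc i)))
ascents-∑ []           = refl
ascents-∑ (a ∷ [])     = refl
ascents-∑ (a ∷ b ∷ xs) = trans (cong (isAscent a b +_) (ascents-∑ (b ∷ xs)))
  (sym (∑-+ 1 (length xs) (λ i → isAscent (at (a ∷ b ∷ xs) i) (at (a ∷ b ∷ xs) (suc i)))))

ascents-∷ʳ-max-nonempty : ∀ {y} xs → 0 < length xs → All (_< y) xs →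
                          ascents (xs ++ [ y ]) ≡ suc (ascents xs)
ascents-∷ʳ-max-nonempty (x ∷ xs) _ xs<y =
  trans (ascents-∷ʳ-max (x ∷ xs) xs<y) (cong suc (ascents-map-suc (x ∷ xs)))

module Word (c : ℕ) where

  N n : ℕ
  N = suc c
  n = suc N

  open Mod n

  word : List ℕ → ℕ → ℕ
  word u i = at (u ++ [ N ]) (i % n)

  module _ {u} (u↭ : IsPerm N u) where

    closed↭ : IsPerm n (u ++ [ N ])
    closed↭ = subst (u ++ [ N ] ↭_) (upTo-∷ʳ N) (++⁺ʳ [ N ] u↭)

    length-closed : length (u ++ [ N ]) ≡ n
    length-closed = IsPerm.length≡ closed↭

    index< : ∀ i → i % n < length (u ++ [ N ])
    index< i = subst (i % n <_) (sym length-closed) (m%n<n i n)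

    word-cyclic : CyclicWord (word u)
    word-cyclic = record
      { bounded   = λ i → All.lookup (IsPerm.bounded closed↭) (at-∈ (u ++ [ N ]) (index< i))
      ; periodic  = λ i → cong (at (u ++ [ N ])) ([m+n]%n≡m%n i n)
      ; injective = λ {i} {j} → at-injective (IsPerm.unique closed↭) (index< i) (index< j)
      }

    open CyclicWord word-cyclic

    word-N : word u N ≡ N
    word-N = begin
      at (u ++ [ N ]) (N % n)          ≡⟨ cong (at (u ++ [ N ])) (m<n⇒m%n≡m ≤-refl) ⟩
      at (u ++ [ N ]) N                ≡⟨ cong (at (u ++ [ N ])) (trans (sym (IsPerm.length≡ u↭)) N≡N+0) ⟩
      at (u ++ [ N ]) (length u + 0)   ≡⟨ at-++ʳ u 0 ⟩
      N                                ∎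
      where
      open ≡-Reasoning
      N≡N+0 : length u ≡ length u + 0
      N≡N+0 = sym (+-identityʳ _)

    word-ascents : cyclicAscents ≡ suc (ascents u)
    word-ascents = begin
      ∑ N ascent + ascent N                  ≡⟨ cong₂ _+_ (∑-cong N inner) last ⟩
      ∑ N adjacent + 0                       ≡⟨ +-identityʳ _ ⟩
      ∑ N adjacent                           ≡⟨ cong (λ L → ∑ (L ∸ 1) adjacent) length-closed ⟨
      ∑ (length (u ++ [ N ]) ∸ 1) adjacent   ≡⟨ ascents-∑ (u ++ [ N ]) ⟨
      ascents (u ++ [ N ])                   ≡⟨ ascents-∷ʳ-max-nonempty u nonempty (IsPerm.bounded u↭) ⟩
      suc (ascents u)                        ∎
      where
      open ≡-Reasoning
      adjacent : ℕ → ℕ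
      adjacent i = isAscent (at (u ++ [ N ]) i) (at (u ++ [ N ]) (suc i))
      inner : ∀ {i} → i < N → ascent i ≡ adjacent i
      inner i<N = cong₂ isAscent (cong (at (u ++ [ N ])) (m<n⇒m%n≡m (m<n⇒m<1+n i<N)))
                                 (cong (at (u ++ [ N ])) (m<n⇒m%n≡m (s≤s i<N)))
      last : ascent N ≡ 0
      last = trans (cong (λ x → isAscent x (word u n)) word-N)
                   (cong (λ b → if b then 1 else 0) (≮⇒<ᵇ≡false (≤⇒≯ (s≤s⁻¹ (bounded n)))))
      nonempty : 0 < length u
      nonempty = subst (0 <_) (sym (IsPerm.length≡ u↭)) z<s

  word-cyclicShift : ∀ {u} → IsPerm N u →
                     ∃ λ r → ∀ i → word (cyclicShift c u) i ≡ (word u (i + r) + 1) % n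
  word-cyclicShift {u} u↭ = length x , λ i → begin
    at (cyclicShift c u ++ [ N ]) (i % n)   ≡⟨ cong (λ v → at v (i % n)) shift-closed ⟩
    at (map next (y ++ x)) (i % n)          ≡⟨ at-map next (y ++ x) (i%n<yx i) ⟩
    next (at (y ++ x) (i % n))              ≡⟨ cong next (at-rotate x y length-xy i) ⟩
    next (at (x ++ y) ((i + length x) % n)) ≡⟨ cong (λ v → next (at v ((i + length x) % n))) u-closed ⟨
    next (word u (i + length x))            ∎
    where
    open ≡-Reasoning
    open MaxSplit (maxSplit c u↭) renaming (before to α; after to β)
    next : ℕ → ℕ
    next v = (v + 1) % n
    x y : List ℕ
    x = α ++ [ c ]
    y = β ++ [ N ]
    u-closed : u ++ [ N ] ≡ x ++ y
    u-closed = trans (cong (_++ [ N ]) u≡)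
                     (trans (++-assoc α (c ∷ β) [ N ]) (sym (++-assoc α [ c ] y)))
    length-xy : length x + length y ≡ n
    length-xy = trans (sym (length-++ x)) (trans (cong length (sym u-closed)) (length-closed u↭))
    i%n<yx : ∀ i → i % n < length (y ++ x)
    i%n<yx i = subst (i % n <_) (sym (trans (length-++ y) (trans (+-comm (length y) _) length-xy)))
                     (m%n<n i n)
    next-small : ∀ {v} → v < c → next v ≡ suc v
    next-small {v} v<c = trans (cong (_% n) (+-comm v 1)) (m<n⇒m%n≡m (s≤s (m<n⇒m<1+n v<c)))
    shift-closed : cyclicShift c u ++ [ N ] ≡ map next (y ++ x)
    shift-closed = sym (begin
      map next ((β ++ [ N ]) ++ α ++ [ c ])        ≡⟨ cong (map next) (++-assoc β [ N ] x) ⟩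
      map next (β ++ N ∷ α ++ [ c ])              ≡⟨ map-++ next β (N ∷ x) ⟩
      map next β ++ next N ∷ map next (α ++ [ c ])
        ≡⟨ cong (map next β ++_) (cong (next N ∷_) (map-++ next α [ c ])) ⟩
      map next β ++ next N ∷ map next α ++ [ next c ]
        ≡⟨ cong₂ (λ b z → b ++ z ∷ map next α ++ [ next c ]) (map-cong-local (All.map next-small after<c))
                 (trans (cong (_% n) (+-comm N 1)) (n%n≡0 n)) ⟩
      map suc β ++ 0 ∷ map next α ++ [ next c ]
        ≡⟨ cong₂ (λ a z → map suc β ++ 0 ∷ a ++ [ z ]) (map-cong-local (All.map next-small before<c))
                 (trans (cong (_% n) (+-comm c 1)) (m<n⇒m%n≡m ≤-refl)) ⟩
      map suc β ++ 0 ∷ map suc α ++ [ N ]          ≡⟨ ++-assoc (map suc β) (0 ∷ map suc α) [ N ] ⟨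
      (map suc β ++ 0 ∷ map suc α) ++ [ N ]        ≡⟨ cong (_++ [ N ]) cyclicShift≡ ⟨
      cyclicShift c u ++ [ N ]                     ∎)

  cyclicShift^ : ℕ → List ℕ → List ℕ
  cyclicShift^ j u = fold u (cyclicShift c) j

  cyclicShift^-perm : ∀ j {u} → IsPerm N u → IsPerm N (cyclicShift^ j u)
  cyclicShift^-perm zero    u↭ = u↭
  cyclicShift^-perm (suc j) u↭ = cyclicShift-perm c (cyclicShift^-perm j u↭)

  word-cyclicShift^ : ∀ j {u} → IsPerm N u →
                      ∃ λ r → ∀ i → word (cyclicShift^ j u) i ≡ (word u (i + r) + j) % n
  word-cyclicShift^ zero {u} u↭ = 0 , λ i → sym (begin
    (word u (i + 0) + 0) % n ≡⟨ cong₂ (λ k m → (word u k + m) % n) (+-identityʳ i) refl ⟩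
    (word u i + 0) % n       ≡⟨ cong (_% n) (+-identityʳ (word u i)) ⟩
    word u i % n             ≡⟨ m<n⇒m%n≡m (CyclicWord.bounded (word-cyclic u↭) i) ⟩
    word u i                 ∎)
    where open ≡-Reasoning
  word-cyclicShift^ (suc j) {u} u↭
    with r , shifted ← word-cyclicShift^ j u↭
       | r′ , shifted′ ← word-cyclicShift (cyclicShift^-perm j u↭) = r′ + r , λ i → begin
    word (cyclicShift c (cyclicShift^ j u)) i   ≡⟨ shifted′ i ⟩
    (word (cyclicShift^ j u) (i + r′) + 1) % n  ≡⟨ cong (λ v → (v + 1) % n) (shifted (i + r′)) ⟩
    ((word u (i + r′ + r) + j) % n + 1) % n     ≡⟨ %-absorbˡ (word u (i + r′ + r) + j) 1 ⟩
    (word u (i + r′ + r) + j + 1) % n           ≡⟨ cong (_% n) (+-assoc (word u (i + r′ + r)) j 1) ⟩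
    (word u (i + r′ + r) + (j + 1)) % n
      ≡⟨ cong₂ (λ k m → (word u k + m) % n) (+-assoc i r′ r) (+-comm j 1) ⟩
    (word u (i + (r′ + r)) + suc j) % n         ∎
    where open ≡-Reasoning

  cyclicShift^-period : ∀ {u} → IsPerm N u → cyclicShift^ n u ≡ u
  cyclicShift^-period {u} u↭ with r , shifted ← word-cyclicShift^ n u↭ = at-ext v u same-length agree
    where
    open ≡-Reasoning
    open CyclicWord (word-cyclic u↭)
    v : List ℕ
    v = cyclicShift^ n u
    v↭ : IsPerm N v
    v↭ = cyclicShift^-perm n u↭
    same-length : length v ≡ length u
    same-length = trans (IsPerm.length≡ v↭) (sym (IsPerm.length≡ u↭))
    rotated : ∀ i → word v i ≡ word u (i + r)
    rotated i = trans (shifted i) (trans ([m+n]%n≡m%n (word u (i + r)) n) (m<n⇒m%n≡m (bounded (i + r))))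
    r≡0 : r % n ≡ 0 % n
    r≡0 = +-cancelˡ-% N (begin
      (N + r) % n   ≡⟨ injective {N + r} {N} (trans (sym (rotated N)) (trans (word-N v↭) (sym (word-N u↭)))) ⟩
      N % n         ≡⟨ cong (_% n) (+-identityʳ N) ⟨
      (N + 0) % n   ∎)
    agree : ∀ {i} → i < length v → at v i ≡ at u i
    agree {i} i<v = begin
      at v i                    ≡⟨ at-++ˡ v i<v ⟨
      at (v ++ [ N ]) i         ≡⟨ cong (at (v ++ [ N ])) i%n≡i ⟨
      word v i                  ≡⟨ rotated i ⟩
      word u (i + r)            ≡⟨ cong (at (u ++ [ N ])) (+-congˡ-% i r≡0) ⟩
      word u (i + 0)            ≡⟨ cong (word u) (+-identityʳ i) ⟩
      at (u ++ [ N ]) (i % n)   ≡⟨ cong (at (u ++ [ N ])) i%n≡i ⟩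
      at (u ++ [ N ]) i         ≡⟨ at-++ˡ u (subst (i <_) same-length i<v) ⟩
      at u i                    ∎
      where
      i%n≡i : i % n ≡ i
      i%n≡i = m<n⇒m%n≡m (m<n⇒m<1+n (subst (i <_) (IsPerm.length≡ v↭) i<v))

  cyclicShift^-aperiodic : ∀ {u p M} → IsPerm N u → 1 < p → p * M ≡ n → p ∣ suc (ascents u) →
                           cyclicShift^ M u ≢ u
  cyclicShift^-aperiodic {u} {p} {M} u↭ 1<p pM≡n p∣ fixed with r , shifted ← word-cyclicShift^ M u↭ =
    symmetry⇒∤cyclicAscents (word-cyclic u↭) symmetry 1<p pM≡n (subst (p ∣_) (sym (word-ascents u↭)) p∣)
    where
    symmetry : ∀ i → word u i ≡ (word u (i + r) + M) % n
    symmetry i = subst (λ v → word v i ≡ (word u (i + r) + M) % n) fixed (shifted i)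

-- Counting by ascents and inversion parity

open import Data.Integer using (ℤ; +_; -[1+_]; _-_)
import Data.Integer.Properties as ℤ
open import Data.Integer.Divisibility using () renaming (_∣_ to _∣ℤ_)
import Data.Integer.Divisibility.Signed as Signed

module Counting (c t : ℕ) (c-odd : c ≡ suc (t * 2)) where

  open Word c

  selected : ℕ → (Bool → Bool) → List (List ℕ)
  selected j g = filterᵇ (λ w → hasAscents (+ j) w ∧ g (evenInv w)) (perms N)

  module _ {j : ℕ} {g : Bool → Bool} where

    ∈-selected⁻ : ∀ {u} → u ∈ selected j g → IsPerm N u × ascents u ≡ j
    ∈-selected⁻ {u} u∈ with u∈perms , holds ← ∈-filter⁻ _ {xs = perms N} u∈ =
      ∈-perms⁻ N u∈perms ,
      ℤ.+-injective (toWitness (proj₁ (Equivalence.to (T-∧ {hasAscents (+ j) u}) holds)))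

    cyclicShift-selected : ∀ {u} → u ∈ selected j g → cyclicShift c u ∈ selected j g
    cyclicShift-selected {u} u∈ with u∈perms , holds ← ∈-filter⁻ _ {xs = perms N} u∈ =
      ∈-filter⁺ _ (∈-perms⁺ N (cyclicShift-perm c u↭)) (subst T (sym same-test) holds)
      where
      u↭ : IsPerm N u
      u↭ = ∈-perms⁻ N u∈perms
      same-test : hasAscents (+ j) (cyclicShift c u) ∧ g (evenInv (cyclicShift c u)) ≡
                  hasAscents (+ j) u ∧ g (evenInv u)
      same-test = cong₂ (λ a e → ⌊ + a ℤ.≟ + j ⌋ ∧ g e)
                        (ascents-cyclicShift c u↭) (evenInv-cyclicShift {t = t} c-odd u↭)

    cyclicShift^-selected : ∀ k {u} → u ∈ selected j g → cyclicShift^ k u ∈ selected j g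
    cyclicShift^-selected zero    u∈ = u∈
    cyclicShift^-selected (suc k) u∈ = cyclicShift-selected (cyclicShift^-selected k u∈)

    selected-divisible : ∀ {p m M} → Prime p → M * p ^ suc m ≡ n → p ∣ suc j →
                         p ^ suc m ∣ length (selected j g)
    selected-divisible {p} {m} {M} p-prime M*q≡n p∣1+j =
      period∣length (Unique.filter⁺ _ (perms-unique N)) (record
        { closed    = cyclicShift^-selected M
        ; periodic  = periodic
        ; aperiodic = λ u∈ → prime-power-period step m p-prime (periodic u∈) (not-fixed u∈)
        })
      where
      instance
        p≢0 : NonZero p
        p≢0 = prime⇒nonZero p-prime
        q≢0 : NonZero (p ^ suc m)
        q≢0 = m^n≢0 p (suc m)
      q : ℕ
      q = p ^ suc m
      step : List ℕ → List ℕ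
      step = cyclicShift^ M
      open Orbit (≡-dec _≟_) step q
      periodic : ∀ {u} → u ∈ selected j g → fold u step q ≡ u
      periodic {u} u∈ = begin
        fold u step q          ≡⟨ fold-fold _ u M q ⟩
        cyclicShift^ (q * M) u ≡⟨ cong (λ k → cyclicShift^ k u) (trans (*-comm q M) M*q≡n) ⟩
        cyclicShift^ n u       ≡⟨ cyclicShift^-period (proj₁ (∈-selected⁻ u∈)) ⟩
        u                      ∎
        where open ≡-Reasoning
      not-fixed : ∀ {u} → u ∈ selected j g → fold u step (p ^ m) ≢ u
      not-fixed {u} u∈ fixed with u↭ , ascents≡j ← ∈-selected⁻ u∈ =
        cyclicShift^-aperiodic u↭ (nonTrivial⇒n>1 p {{prime⇒nonTrivial p-prime}})
          (trans (sym (*-assoc p (p ^ m) M)) (trans (*-comm q M) M*q≡n))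
          (subst (λ a → p ∣ suc a) (sym ascents≡j) p∣1+j)
          (trans (sym (fold-fold _ u M (p ^ m))) fixed)

hasAscents-negative : ∀ j w → hasAscents -[1+ j ] w ≡ false
hasAscents-negative j w with + ascents w ℤ.≟ -[1+ j ]
... | no _ = refl

negative-count : ∀ N j (g : Bool → Bool) →
                 length (filterᵇ (λ w → hasAscents -[1+ j ] w ∧ g (evenInv w)) (perms N)) ≡ 0
negative-count N j g = cong length (filter-none (λ w → T? (hasAscents -[1+ j ] w ∧ g (evenInv w)))
                                                (All.universal rejected (perms N)))
  where
  rejected : ∀ w → ¬ T (hasAscents -[1+ j ] w ∧ g (evenInv w))
  rejected w = subst (λ b → ¬ T (b ∧ g (evenInv w))) (sym (hasAscents-negative j w)) (λ ())

odd⇒1+2t : ∀ n → ¬ 2 ∣ n → ∃ λ t → n ≡ suc (t * 2)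
odd⇒1+2t n 2∤n with n % 2 | m%n<n n 2 | m≡m%n+[m/n]*n n 2 | m%n≡0⇒n∣m n 2
... | zero        | _                | _  | 2∣n = contradiction (2∣n refl) 2∤n
... | suc zero    | _                | n≡ | _   = n / 2 , n≡
... | suc (suc _) | s≤s (s≤s ())    | _  | _

∣ℤ-difference : ∀ {q a b} → q ∣ a → q ∣ b → + q ∣ℤ (+ a - + b)
∣ℤ-difference {q} {a} {b} q∣a q∣b =
  Signed.∣⇒∣ᵤ (Signed.∣m∣n⇒∣m-n (Signed.∣ᵤ⇒∣ {+ q} {+ a} q∣a) (Signed.∣ᵤ⇒∣ {+ q} {+ b} q∣b))

count-divisible : ∀ {p m M t} → Prime p → M * p ^ suc m ≡ suc (suc (suc (t * 2))) →
                  ∀ k → + p ∣ℤ k → ∀ (g : Bool → Bool) →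
                  p ^ suc m ∣ length (filterᵇ (λ w → hasAscents (k - + 1) w ∧ g (evenInv w))
                                              (perms (suc (suc (t * 2)))))
count-divisible {p} {m} {t = t} _ _ (+ zero) _ g =
  subst (p ^ suc m ∣_) (sym (negative-count (suc (suc (t * 2))) 0 g)) ((p ^ suc m) ∣0)
count-divisible {p} {m} {M} {t} p-prime M*q≡n (+ suc j) p∣1+j g =
  Counting.selected-divisible (suc (t * 2)) t refl {g = g} {m = m} {M} p-prime M*q≡n p∣1+j
count-divisible {p} {m} {t = t} _ _ -[1+ j ] _ g =
  subst (p ^ suc m ∣_) (sym (negative-count (suc (suc (t * 2))) (suc j) g)) ((p ^ suc m) ∣0)

corollary5p2 : (p m n : ℕ) (k : ℤ) → Prime p → 1 ≤ m → ¬ (2 ∣ n) → (p ^ m) ∣ n → (+ p) ∣ℤ k →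
    ((p ^ m) ∣ B (n ∸ 1) (k - + 1)) × ((p ^ m) ∣ C (n ∸ 1) (k - + 1)) × ((+ (p ^ m)) ∣ℤ D (n ∸ 1) (k - + 1))
corollary5p2 p (suc m) n k p-prime _ 2∤n p^m∣n p∣k with odd⇒1+2t n 2∤n | p^m∣n
... | zero  , refl | q∣1 =
  contradiction (m*n≡1⇒m≡1 p (p ^ m) (∣1⇒≡1 q∣1)) (nonTrivial⇒≢1 {{prime⇒nonTrivial p-prime}})
... | suc t , refl | divides M n≡M*q = count id , count not , ∣ℤ-difference (count id) (count not)
  where
  count : ∀ g → p ^ suc m ∣ length (filterᵇ (λ w → hasAscents (k - + 1) w ∧ g (evenInv w))
                                           (perms (suc (suc (t * 2)))))
  count = count-divisible {m = m} {M} {t} p-prime (sym n≡M*q) k p∣k
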